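{- Let $\Gamma\cup\{\varphi,\psi,\gamma\}$ be formulas, let $\delta_1,\delta_2\in\{\varphi,\psi\}$ with $\delta_1\neq\delta_2$, and let $T$ be a derivation in $\mathsf{R}'_{\mathrm{BK}}$ witnessing $\Gamma,\varphi\lor\psi,\delta_1\vdash_{\mathsf{R}'_{\mathrm{BK}}}\gamma$. If an instance of rule (1$\star$) $p,\neg p/q$ is applied in $T$, then $\Gamma,\varphi\lor\psi\vdash_{\mathsf{R}'_{\mathrm{BK}}}\delta_2$.
   Context: Formulas are built from a countably infinite set of variables with binary $\land,\lor$ and unary $\neg$. Set-Fmla Hilbert systems: rule schemas $\gamma_1,\dots,\gamma_m/\varphi$ with all substitution instances; $\Gamma\vdash_{\mathsf R}\varphi$ iff some finite sequence (a derivation) ending in $\varphi$ has each member in $\Gamma$ or the conclusion of a rule instance whose premises occur earlier. The $\lor$-lifted version of a rule $\gamma_1,\dots,\gamma_m/\varphi$ is $s\lor\gamma_1,\dots,s\lor\gamma_m/s\lor\varphi$ with $s$ a variable not occurring in the rule. $\mathsf{R}'_{\mathrm{BK}}$ has rule schemas ($p,q,r$ distinct): (1$\star$) $p,\neg p/q$; (2) $p/\neg\neg p$; (3) $\neg\neg p/p$; (4) $p,q/p\land q$; (5) $\neg p,\neg q/\neg(p\land q)$; (6) $\neg p,q/\neg(p\land q)$; (7) $p,\neg q/\neg(p\land q)$; (8$\star$) $\neg(p\land q)/\neg p\lor p$; (9$\star$) $\neg(p\land q)/\neg q\lor q$; (10) $p\land q/p$; (11) $p\land q/q$; (12) $\neg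 p,\neg q/\neg(p\lor q)$; (13) $\neg(p\lor q)/\neg p$; (14) $\neg(p\lor q)/\neg q$; (15$\star$) $p\lor q/p\lor\neg p$; (16$\star$) $p\lor q/q\lor\neg q$; (17) $\neg p,q/p\lor q$; (18) $p,\neg q/p\lor q$; (19) $p,q/p\lor q$; (20) $p\lor q,\neg p/q$; (21) $p\lor(q\lor r)/(p\lor q)\lor r$; (22) $p\lor p/p$; (23) $p\lor q/q\lor p$; (24) $p\lor q,r/\neg p\lor r$; plus the $\lor$-lifted versions of all these except (1$\star$). -}

module Defs where

open import Data.Nat using (ℕ)
open import Data.List using (List; []; _∷_; map)
open import Data.List.Membership.Propositional using (_∈_)
open import Data.List.Relation.Unary.All using (All)
open import Data.List.Relation.Unary.Any using (Any)
open import Data.Product using (Σ; ∃; _×_; _,_)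
open import Data.Sum using (_⊎_)
open import Relation.Binary.PropositionalEquality using (_≡_; _≢_)

infixr 8 _∧_
infixr 7 _∨_

infix 9 ¬_
data Fmla : Set where
  var : ℕ → Fmla
  ¬_  : Fmla → Fmla
  _∧_ : Fmla → Fmla → Fmla
  _∨_ : Fmla → Fmla → Fmla

Subst : Set
Subst = ℕ → Fmla

sub : Subst → Fmla → Fmla
sub σ (var n) = σ n
sub σ (¬ a)   = ¬ sub σ a
sub σ (a ∧ b) = sub σ a ∧ sub σ b
sub σ (a ∨ b) = sub σ a ∨ sub σ b

infix 4 _/_
record Rule : Set where
  constructor _/_
  field
    prems : List Fmla
    concl : Fmla
open Rule public

-- The schematic variables p, q, r, and the variable s used for ∨-lifting
-- (s does not occur in any of the rules (1)–(24)).
p q r s : Fmla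
p = var 0
q = var 1
r = var 2
s = var 3

data RName : Set where
  r1 r2 r3 r4 r5 r6 r7 r8 r9 r10 r11 r12 : RName
  r13 r14 r15 r16 r17 r18 r19 r20 r21 r22 r23 r24 : RName

baseRule : RName → Rule
baseRule r1  = (p ∷ ¬ p ∷ []) / q
baseRule r2  = (p ∷ []) / (¬ ¬ p)
baseRule r3  = (¬ ¬ p ∷ []) / p
baseRule r4  = (p ∷ q ∷ []) / (p ∧ q)
baseRule r5  = (¬ p ∷ ¬ q ∷ []) / (¬ (p ∧ q))
baseRule r6  = (¬ p ∷ q ∷ []) / (¬ (p ∧ q))
baseRule r7  = (p ∷ ¬ q ∷ []) / (¬ (p ∧ q))
baseRule r8  = (¬ (p ∧ q) ∷ []) / (¬ p ∨ p)
baseRule r9  = (¬ (p ∧ q) ∷ []) / (¬ q ∨ q)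
baseRule r10 = (p ∧ q ∷ []) / p
baseRule r11 = (p ∧ q ∷ []) / q
baseRule r12 = (¬ p ∷ ¬ q ∷ []) / (¬ (p ∨ q))
baseRule r13 = (¬ (p ∨ q) ∷ []) / (¬ p)
baseRule r14 = (¬ (p ∨ q) ∷ []) / (¬ q)
baseRule r15 = (p ∨ q ∷ []) / (p ∨ ¬ p)
baseRule r16 = (p ∨ q ∷ []) / (q ∨ ¬ q)
baseRule r17 = (¬ p ∷ q ∷ []) / (p ∨ q)
baseRule r18 = (p ∷ ¬ q ∷ []) / (p ∨ q)
baseRule r19 = (p ∷ q ∷ []) / (p ∨ q)
baseRule r20 = (p ∨ q ∷ ¬ p ∷ []) / q
baseRule r21 = (p ∨ (q ∨ r) ∷ []) / ((p ∨ q) ∨ r)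
baseRule r22 = (p ∨ p ∷ []) / p
baseRule r23 = (p ∨ q ∷ []) / (q ∨ p)
baseRule r24 = (p ∨ q ∷ r ∷ []) / (¬ p ∨ r)

liftRule : Rule → Rule
liftRule (γs / φ) = map (s ∨_) γs / (s ∨ φ)

data RuleId : Set where
  plain  : RName → RuleId
  lifted : (n : RName) → n ≢ r1 → RuleId

rule : RuleId → Rule
rule (plain n)    = baseRule n
rule (lifted n _) = liftRule (baseRule n)

-- Sets of formulas (possibly infinite) as predicates.
FSet : Set₁
FSet = Fmla → Set

_,,_ : FSet → Fmla → FSet
(Γ ,, a) x = Γ x ⊎ x ≡ a

data Step (Γ : FSet) (prev : List Fmla) : Fmla → Set where
  hyp : ∀ {a} → Γ a → Step Γ prev a
  app : (ρ : RuleId) (σ : Subst) →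
        All (_∈ prev) (map (sub σ) (prems (rule ρ))) →
        Step Γ prev (sub σ (concl (rule ρ)))

-- A derivation from Γ whose members (listed last-first) are `fs`.
data Deriv (Γ : FSet) : List Fmla → Set where
  []  : Deriv Γ []
  _▷_ : ∀ {prev a} → Deriv Γ prev → Step Γ prev a → Deriv Γ (a ∷ prev)

_⊢_ : FSet → Fmla → Set
Γ ⊢ a = Σ (List Fmla) λ prev → Deriv Γ (a ∷ prev)

data UsesR1 {Γ : FSet} : {fs : List Fmla} → Deriv Γ fs → Set where
  here  : ∀ {prev} (T : Deriv Γ prev) (σ : Subst) ps →
          UsesR1 (T ▷ app (plain r1) σ ps)
  there : ∀ {prev a} {T : Deriv Γ prev} (st : Step Γ prev a) →
          UsesR1 T → UsesR1 (T ▷ st)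

-- Cut T at its first application of (1★): the formulas a and ¬ a it consumes
-- are derived from Γ, φ ∨ ψ, δ₁ without (1★).  Every rule other than (1★) has
-- a ∨-lifted version, so such a derivation can be replayed under the side
-- disjunct δ₂, the hypothesis δ₁ becoming δ₂ ∨ δ₁ (which is φ ∨ ψ up to
-- commutation).  This gives δ₂ ∨ a and δ₂ ∨ ¬ a, and rule (20) lifted by δ₂
-- collapses them to δ₂.
module Submission where

open import Defs
open import Data.List using (List; []; _∷_; _++_; map)
open import Data.List.Membership.Propositional using (_∈_)
open import Data.List.Membership.Propositional.Properties using (∈-++⁺ˡ; ∈-++⁺ʳ)
open import Data.List.Relation.Unary.All as All using (All; []; _∷_)
open import Data.List.Relation.Unary.Any using (here)
open import Data.Product using (∃; _×_; _,_)
open import Data.Sum using (_⊎_; inj₁; inj₂)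
open import Data.Empty using (⊥-elim)
open import Relation.Binary.PropositionalEquality using (_≡_; _≢_; refl)

inst : Fmla → Fmla → Fmla → Fmla → Subst
inst a b c e 0 = a
inst a b c e 1 = b
inst a b c e 2 = c
inst a b c e _ = e

_[s≔_] : Subst → Fmla → Subst
(σ [s≔ e ]) 3 = e
(σ [s≔ e ]) n = σ n

isR1? : (ρ : RuleId) → ρ ≡ plain r1 ⊎ ρ ≢ plain r1
isR1? (plain r1)   = inj₁ refl
isR1? (plain r2)   = inj₂ λ ()
isR1? (plain r3)   = inj₂ λ ()
isR1? (plain r4)   = inj₂ λ ()
isR1? (plain r5)   = inj₂ λ ()
isR1? (plain r6)   = inj₂ λ ()
isR1? (plain r7)   = inj₂ λ ()
isR1? (plain r8)   = inj₂ λ ()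
isR1? (plain r9)   = inj₂ λ ()
isR1? (plain r10)  = inj₂ λ ()
isR1? (plain r11)  = inj₂ λ ()
isR1? (plain r12)  = inj₂ λ ()
isR1? (plain r13)  = inj₂ λ ()
isR1? (plain r14)  = inj₂ λ ()
isR1? (plain r15)  = inj₂ λ ()
isR1? (plain r16)  = inj₂ λ ()
isR1? (plain r17)  = inj₂ λ ()
isR1? (plain r18)  = inj₂ λ ()
isR1? (plain r19)  = inj₂ λ ()
isR1? (plain r20)  = inj₂ λ ()
isR1? (plain r21)  = inj₂ λ ()
isR1? (plain r22)  = inj₂ λ ()
isR1? (plain r23)  = inj₂ λ ()
isR1? (plain r24)  = inj₂ λ ()
isR1? (lifted _ _) = inj₂ λ ()

infix 3 _⊢⁻_
data _⊢⁻_ (Γ : FSet) : Fmla → Set where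
  hyp : ∀ {a} → Γ a → Γ ⊢⁻ a
  ap  : (ρ : RuleId) → ρ ≢ plain r1 → (σ : Subst) →
        All (Γ ⊢⁻_) (map (sub σ) (prems (rule ρ))) →
        Γ ⊢⁻ sub σ (concl (rule ρ))

Contradictory⁻ : FSet → Set
Contradictory⁻ Γ = ∃ λ a → (Γ ⊢⁻ a) × (Γ ⊢⁻ ¬ a)

module _ {Γ : FSet} where

  Step-weaken : ∀ {prev a} xs → Step Γ prev a → Step Γ (prev ++ xs) a
  Step-weaken xs (hyp g)      = hyp g
  Step-weaken xs (app ρ σ ps) = app ρ σ (All.map ∈-++⁺ˡ ps)

  Deriv-++ : ∀ {xs ys} → Deriv Γ xs → Deriv Γ ys → Deriv Γ (ys ++ xs)
  Deriv-++ S []       = S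
  Deriv-++ S (T ▷ st) = Deriv-++ S T ▷ Step-weaken _ st

  mutual
    ⊢⁻⇒⊢ : ∀ {a} → Γ ⊢⁻ a → Γ ⊢ a
    ⊢⁻⇒⊢ (hyp g) = [] , ([] ▷ hyp g)
    ⊢⁻⇒⊢ (ap ρ _ σ ps) with ⊢⁻⇒Deriv ps
    ... | fs , T , ms = fs , (T ▷ app ρ σ ms)

    ⊢⁻⇒Deriv : ∀ {as} → All (Γ ⊢⁻_) as → ∃ λ fs → Deriv Γ fs × All (_∈ fs) as
    ⊢⁻⇒Deriv [] = [] , [] , []
    ⊢⁻⇒Deriv (h ∷ hs) with ⊢⁻⇒⊢ h | ⊢⁻⇒Deriv hs
    ... | prev , T | fs , U , ms =
      (_ ∷ prev) ++ fs , Deriv-++ U T ,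
      ∈-++⁺ˡ {ys = fs} (here refl) ∷ All.map (∈-++⁺ʳ (_ ∷ prev)) ms

  Deriv⇒⊢⁻⊎Contradictory⁻ : ∀ {fs} → Deriv Γ fs → Contradictory⁻ Γ ⊎ All (Γ ⊢⁻_) fs
  Deriv⇒⊢⁻⊎Contradictory⁻ [] = inj₂ []
  Deriv⇒⊢⁻⊎Contradictory⁻ (T ▷ st) with Deriv⇒⊢⁻⊎Contradictory⁻ T
  ... | inj₁ c  = inj₁ c
  ... | inj₂ ds = extend st
    where
    extend : ∀ {a} → Step Γ _ a → Contradictory⁻ Γ ⊎ All (Γ ⊢⁻_) (a ∷ _)
    extend (hyp g) = inj₂ (hyp g ∷ ds)
    extend (app ρ σ ps) with isR1? ρ
    extend (app _ σ (m ∷ m¬ ∷ [])) | inj₁ refl = inj₁ (σ 0 , All.lookup ds m , All.lookup ds m¬)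
    ... | inj₂ ρ≢r1 = inj₂ (ap ρ ρ≢r1 σ (All.map (All.lookup ds) ps) ∷ ds)

  UsesR1⇒Contradictory⁻ : ∀ {fs} {T : Deriv Γ fs} → UsesR1 T → Contradictory⁻ Γ
  UsesR1⇒Contradictory⁻ (there _ u) = UsesR1⇒Contradictory⁻ u
  UsesR1⇒Contradictory⁻ (here T σ (m ∷ m¬ ∷ [])) with Deriv⇒⊢⁻⊎Contradictory⁻ T
  ... | inj₁ c  = c
  ... | inj₂ ds = σ 0 , All.lookup ds m , All.lookup ds m¬

  ∨-comm : ∀ {a b} → Γ ⊢⁻ a ∨ b → Γ ⊢⁻ b ∨ a
  ∨-comm {a} {b} h = ap (plain r23) (λ ()) (inst a b a a) (h ∷ [])

  ∨-assocˡ : ∀ {a b c} → Γ ⊢⁻ a ∨ (b ∨ c) → Γ ⊢⁻ (a ∨ b) ∨ c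
  ∨-assocˡ {a} {b} {c} h = ap (plain r21) (λ ()) (inst a b c a) (h ∷ [])

  ∨-assocʳ : ∀ {a b c} → Γ ⊢⁻ (a ∨ b) ∨ c → Γ ⊢⁻ a ∨ (b ∨ c)
  ∨-assocʳ {a} {b} {c} h =
    ap (lifted r23 (λ ())) (λ ()) (inst c b c a)
      (∨-comm (∨-assocˡ (ap (lifted r23 (λ ())) (λ ()) (inst a b a c) (∨-comm h ∷ [])))
       ∷ [])

  ∨-excluded-middle : ∀ {a b} → Γ ⊢⁻ a ∨ b → Γ ⊢⁻ ¬ a ∨ a
  ∨-excluded-middle {a} {b} h = ∨-comm (ap (plain r15) (λ ()) (inst a b a a) (h ∷ []))

  -- Rule (24) turns ¬ a ∨ a and c into ¬ ¬ a ∨ c; lifted (3) removes ¬ ¬.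
  ∨-weaken : ∀ {a b c} → Γ ⊢⁻ a ∨ b → Γ ⊢⁻ c → Γ ⊢⁻ a ∨ c
  ∨-weaken {a} {b} {c} h hc =
    ∨-comm (ap (lifted r3 (λ ())) (λ ()) (inst a a a c)
      (∨-comm (ap (plain r24) (λ ()) (inst (¬ a) a c c) (∨-excluded-middle h ∷ hc ∷ [])) ∷ []))

  ∨-contradiction : ∀ {d a} → Γ ⊢⁻ d ∨ a → Γ ⊢⁻ d ∨ ¬ a → Γ ⊢⁻ d
  ∨-contradiction {d} {a} h h¬ =
    ap (plain r22) (λ ()) (inst d d d d)
      (ap (lifted r20 (λ ())) (λ ()) (inst a d d d) (∨-weaken h (∨-comm h) ∷ h¬ ∷ []) ∷ [])

  -- Each clause typechecks by computation because s does not occur in rule n.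
  apply-lifted : ∀ n → n ≢ r1 → ∀ σ e →
    All (Γ ⊢⁻_) (map (e ∨_) (map (sub σ) (prems (baseRule n)))) →
    Γ ⊢⁻ e ∨ sub σ (concl (baseRule n))
  apply-lifted r1  r≢r1 σ e _ = ⊥-elim (r≢r1 refl)
  apply-lifted r2  _ σ e = ap (lifted r2  λ ()) (λ ()) (σ [s≔ e ])
  apply-lifted r3  _ σ e = ap (lifted r3  λ ()) (λ ()) (σ [s≔ e ])
  apply-lifted r4  _ σ e = ap (lifted r4  λ ()) (λ ()) (σ [s≔ e ])
  apply-lifted r5  _ σ e = ap (lifted r5  λ ()) (λ ()) (σ [s≔ e ])
  apply-lifted r6  _ σ e = ap (lifted r6  λ ()) (λ ()) (σ [s≔ e ])
  apply-lifted r7  _ σ e = ap (lifted r7  λ ()) (λ ()) (σ [s≔ e ])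
  apply-lifted r8  _ σ e = ap (lifted r8  λ ()) (λ ()) (σ [s≔ e ])
  apply-lifted r9  _ σ e = ap (lifted r9  λ ()) (λ ()) (σ [s≔ e ])
  apply-lifted r10 _ σ e = ap (lifted r10 λ ()) (λ ()) (σ [s≔ e ])
  apply-lifted r11 _ σ e = ap (lifted r11 λ ()) (λ ()) (σ [s≔ e ])
  apply-lifted r12 _ σ e = ap (lifted r12 λ ()) (λ ()) (σ [s≔ e ])
  apply-lifted r13 _ σ e = ap (lifted r13 λ ()) (λ ()) (σ [s≔ e ])
  apply-lifted r14 _ σ e = ap (lifted r14 λ ()) (λ ()) (σ [s≔ e ])
  apply-lifted r15 _ σ e = ap (lifted r15 λ ()) (λ ()) (σ [s≔ e ])
  apply-lifted r16 _ σ e = ap (lifted r16 λ ()) (λ ()) (σ [s≔ e ])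
  apply-lifted r17 _ σ e = ap (lifted r17 λ ()) (λ ()) (σ [s≔ e ])
  apply-lifted r18 _ σ e = ap (lifted r18 λ ()) (λ ()) (σ [s≔ e ])
  apply-lifted r19 _ σ e = ap (lifted r19 λ ()) (λ ()) (σ [s≔ e ])
  apply-lifted r20 _ σ e = ap (lifted r20 λ ()) (λ ()) (σ [s≔ e ])
  apply-lifted r21 _ σ e = ap (lifted r21 λ ()) (λ ()) (σ [s≔ e ])
  apply-lifted r22 _ σ e = ap (lifted r22 λ ()) (λ ()) (σ [s≔ e ])
  apply-lifted r23 _ σ e = ap (lifted r23 λ ()) (λ ()) (σ [s≔ e ])
  apply-lifted r24 _ σ e = ap (lifted r24 λ ()) (λ ()) (σ [s≔ e ])

  All-∨-assocˡ : ∀ {d σ} xs →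
    All (Γ ⊢⁻_) (map (d ∨_) (map (sub σ) (map (s ∨_) xs))) →
    All (Γ ⊢⁻_) (map ((d ∨ σ 3) ∨_) (map (sub σ) xs))
  All-∨-assocˡ []       []       = []
  All-∨-assocˡ (_ ∷ xs) (h ∷ hs) = ∨-assocˡ h ∷ All-∨-assocˡ xs hs

module _ {Γ : FSet} {d δ : Fmla} (dδ : Γ ⊢⁻ d ∨ δ) where

  mutual
    ∨-lift : ∀ {a} → Γ ,, δ ⊢⁻ a → Γ ⊢⁻ d ∨ a
    ∨-lift (hyp (inj₁ g))    = ∨-weaken dδ (hyp g)
    ∨-lift (hyp (inj₂ refl)) = dδ
    ∨-lift (ap (plain n) n≢r1 σ ps) =
      apply-lifted n (λ { refl → n≢r1 refl }) σ d (All-∨-lift ps)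
    ∨-lift (ap (lifted n n≢r1) _ σ ps) =
      ∨-assocʳ (apply-lifted n n≢r1 σ (d ∨ σ 3)
        (All-∨-assocˡ (prems (baseRule n)) (All-∨-lift ps)))

    All-∨-lift : ∀ {as} → All (Γ ,, δ ⊢⁻_) as → All (Γ ⊢⁻_) (map (d ∨_) as)
    All-∨-lift []       = []
    All-∨-lift (h ∷ hs) = ∨-lift h ∷ All-∨-lift hs

other-∨-this : ∀ {Γ φ ψ δ₁ δ₂} → Γ ⊢⁻ φ ∨ ψ →
  (δ₁ ≡ φ ⊎ δ₁ ≡ ψ) → (δ₂ ≡ φ ⊎ δ₂ ≡ ψ) → δ₁ ≢ δ₂ → Γ ⊢⁻ δ₂ ∨ δ₁
other-∨-this h (inj₁ refl) (inj₁ refl) δ₁≢δ₂ = ⊥-elim (δ₁≢δ₂ refl)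
other-∨-this h (inj₂ refl) (inj₂ refl) δ₁≢δ₂ = ⊥-elim (δ₁≢δ₂ refl)
other-∨-this h (inj₁ refl) (inj₂ refl) _     = ∨-comm h
other-∨-this h (inj₂ refl) (inj₁ refl) _     = h

proposition9 : (Γ : FSet) (φ ψ γ δ₁ δ₂ : Fmla) →
    (δ₁ ≡ φ ⊎ δ₁ ≡ ψ) → (δ₂ ≡ φ ⊎ δ₂ ≡ ψ) → δ₁ ≢ δ₂ →
    (prev : List Fmla) (T : Deriv ((Γ ,, (φ ∨ ψ)) ,, δ₁) (γ ∷ prev)) →
    UsesR1 T →
    (Γ ,, (φ ∨ ψ)) ⊢ δ₂
proposition9 Γ φ ψ γ δ₁ δ₂ δ₁∈ δ₂∈ δ₁≢δ₂ prev T usesR1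
  with UsesR1⇒Contradictory⁻ usesR1
... | a , ⊢a , ⊢¬a = ⊢⁻⇒⊢ (∨-contradiction (∨-lift δ₂∨δ₁ ⊢a) (∨-lift δ₂∨δ₁ ⊢¬a))
  where
  δ₂∨δ₁ : Γ ,, (φ ∨ ψ) ⊢⁻ δ₂ ∨ δ₁
  δ₂∨δ₁ = other-∨-this (hyp (inj₂ refl)) δ₁∈ δ₂∈ δ₁≢δ₂
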